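{- Let $C>0$, let $k\ge 1$ be an integer, and let $T$ satisfy $0<T<C/k$; set $r=kT/C$ (so $0<r<1$). Then the online algorithm $\textsc{FlushAll}$ is $\frac{2-r}{1-r}$-competitive in the discrete $k$-wallet model $\mathcal{M}^{C,k}_T$: there is a constant $c$ depending only on the model parameters such that for every transaction sequence $\mathsf{Tx}$ with all values at most $T$, \[ V_{\mathrm{OPT}}(\mathsf{Tx}) \le \frac{2-r}{1-r}\, V_{\textsc{FlushAll}}(\mathsf{Tx}) + c. \]
   Context: Discrete $k$-wallet model $\mathcal{M}^{C,k}_T$: Time is divided into discrete slots $t=1,2,\dots$. A transaction sequence is $\mathsf{Tx}=(\mathsf{tx}_1,\dots,\mathsf{tx}_n)$, where $\mathsf{tx}_t\in[0,T]$ is the value of the transaction arriving at slot $t$ (value $0$ means no transaction). A total collateral $C$ is divided into $k$ wallets, each of capacity $C/k$. Each wallet is either online with some available (uncommitted) collateral $R\in[0,C/k]$, or offline. When a transaction of value $v$ arrives, the policy must immediately either settle it, using an online wallet with $R\ge v$ (whose available collateral becomes $R-v$), or discard it. At any time $t$ the policy may flush a wallet; the wallet is then offline during the slots of the interval $(t,t+F]$ (with $F$ a fixed positive integer flush period), after which it is online again with available collateral reset to $C/k$. For a policy $\mathrm{A}$, $V_{\mathrm{A}}(\mathsf{Tx})$ denotes the total value of transactions it settles. An algorithm is online if its decisions at time $N$ depend only on $\mathsf{tx}_1,\dots,\mathsf{tx}_N$. $\mathrm{OPT}$ denotes an optimal offline $k$-wallet policy, i.e. $V_{\mathrm{OPT}}(\mathsf{Tx})$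 is the maximum settled value achievable by any $k$-wallet policy with full knowledge of $\mathsf{Tx}$. An algorithm $\mathrm{A}$ is $\alpha$-competitive in this model if for every sequence $\mathsf{Tx}$ with values at most $T$, $V_{\mathrm{OPT}}(\mathsf{Tx})\le \alpha V_{\mathrm{A}}(\mathsf{Tx})+O(1)$, where the $O(1)$ constant may depend on $C,k,T$ (and $F$) but not on $\mathsf{Tx}$ or its length. Algorithm $\textsc{FlushAll}$: the wallets are placed in a fixed order $W_1,\dots,W_k$. Each arriving transaction is settled by the first wallet in this order that has enough available collateral to fit it (first fit). When a transaction arrives that fits in no wallet, it is discarded and all $k$ wallets are flushed simultaneously (so all transactions arriving during the following flush period are discarded); afterwards the process repeats.
   Formalization: The collateral C, the bound T and the transaction values are rational rather than real. -}

module Defs where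

open import Data.Nat as ℕ using (ℕ; zero; suc)
open import Data.Integer using (+_)
open import Data.Rational using (ℚ; 0ℚ; 1ℚ; _+_; _*_; _-_; _÷_; _≤_; _≤ᵇ_; ≢-nonZero)
  renaming (_/_ to _//_)
open import Data.Rational.Properties using (_≟_)
open import Data.Fin using (Fin)
open import Data.Fin.Subset using (Subset; inside; outside)
open import Data.Maybe using (Maybe; just; nothing)
open import Data.Bool using (Bool; true; false; if_then_else_; _∧_)
open import Data.Vec using (Vec; lookup; replicate; map; zipWith; _[_]≔_; []; _∷_)
open import Data.List using (List; []; _∷_)
open import Data.Product using (_×_; _,_)
open import Relation.Nullary using (yes; no)

ℕ→ℚ : ℕ → ℚ
ℕ→ℚ n = (+ n) // 1

-- total division; only ever used with a nonzero divisor in the theorem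
_÷?_ : ℚ → ℚ → ℚ
p ÷? q with q ≟ 0ℚ
... | yes _  = 0ℚ
... | no q≢0 = (p ÷ q) {{≢-nonZero q≢0}}

walletCap : (C : ℚ) (k : ℕ) → ℚ
walletCap C k = C ÷? ℕ→ℚ k

ratio : (C T : ℚ) (k : ℕ) → ℚ
ratio C T k = (ℕ→ℚ k * T) ÷? C

alpha : (C T : ℚ) (k : ℕ) → ℚ
alpha C T k = ((1ℚ + 1ℚ) - ratio C T k) ÷? (1ℚ - ratio C T k)

-- A wallet is online with available collateral R, or offline for the
-- given number of further slots (counting from the next slot).
data Wallet : Set where
  online  : ℚ → Wallet
  offline : ℕ → Wallet

State : ℕ → Set
State k = Vec Wallet k

initState : (C : ℚ) (k : ℕ) → State k
initState C k = replicate k (online (walletCap C k))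

-- Action taken at one slot: optionally settle the current transaction
-- with a wallet, then flush a set of wallets (at the current time t,
-- so they are offline during slots t+1, ..., t+F).
record Action (k : ℕ) : Set where
  constructor act
  field
    settle : Maybe (Fin k)
    flush  : Subset k

tick : (cap : ℚ) → Wallet → Wallet
tick cap (online R)              = online R
tick cap (offline zero)          = online cap
tick cap (offline (suc zero))    = online cap
tick cap (offline (suc (suc m))) = offline (suc m)

applyFlush : (F : ℕ) → Wallet → Bool → Wallet
applyFlush F w true  = offline F
applyFlush F w false = w

fitsᵇ : ℚ → Wallet → Bool
fitsᵇ v (online R)  = v ≤ᵇ R
fitsᵇ v (offline _) = false

-- Settling step. A settle request that is not allowed (wallet offline or
-- too little available collateral) is treated as a discard; this does
-- not change the set of achievable settled values.
settleStep : {k : ℕ} → State k → ℚ → Maybe (Fin k) → State k × ℚ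
settleStep s v nothing  = s , 0ℚ
settleStep s v (just i) with lookup s i
... | online R  = if v ≤ᵇ R then (s [ i ]≔ online (R - v)) , v else (s , 0ℚ)
... | offline m = s , 0ℚ

-- one full slot: settle/discard, then passage of time for wallets that
-- were already offline, then the flushes performed at this slot
step : (C : ℚ) (k F : ℕ) → State k → ℚ → Action k → State k × ℚ
step C k F s v (act st fl) with settleStep s v st
... | s' , gained =
  zipWith (applyFlush F) (map (tick (walletCap C k)) s') (map isIn fl) , gained
  where
  isIn : _ → Bool
  isIn inside  = true
  isIn outside = false

-- total value settled by an (offline) policy, given as the action taken
-- at each slot (slot index starts at 0 for the first transaction)
valueFrom : (C : ℚ) (k F : ℕ) → (ℕ → Action k) → ℕ → State k → List ℚ → ℚ
valueFrom C k F σ t s []        = 0ℚ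
valueFrom C k F σ t s (v ∷ vs) with step C k F s v (σ t)
... | s' , g = g + valueFrom C k F σ (suc t) s' vs

policyValue : (C : ℚ) (k F : ℕ) → (ℕ → Action k) → List ℚ → ℚ
policyValue C k F σ tx = valueFrom C k F σ 0 (initState C k) tx

-- FlushAll (an online policy: its action depends only on the current
-- state, which is determined by past transactions, and the current value)

firstFit : {k : ℕ} → ℚ → State k → Maybe (Fin k)
firstFit v []       = nothing
firstFit v (w ∷ ws) = if fitsᵇ v w then just Fin.zero else Data.Maybe.map Fin.suc (firstFit v ws)
  where import Data.Fin as Fin; import Data.Maybe

anyOnline : {k : ℕ} → State k → Bool
anyOnline []                = false
anyOnline (online _  ∷ ws)  = true
anyOnline (offline _ ∷ ws)  = anyOnline ws

allSet : (k : ℕ) → Subset k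
allSet k = replicate k inside

noneSet : (k : ℕ) → Subset k
noneSet k = replicate k outside

flushAllAction : {k : ℕ} → State k → ℚ → Action k
flushAllAction {k} s v with firstFit v s
... | just i  = act (just i) (noneSet k)
... | nothing = act nothing (if anyOnline s then allSet k else noneSet k)

flushAllFrom : (C : ℚ) (k F : ℕ) → State k → List ℚ → ℚ
flushAllFrom C k F s []       = 0ℚ
flushAllFrom C k F s (v ∷ vs) with step C k F s v (flushAllAction s v)
... | s' , g = g + flushAllFrom C k F s' vs

flushAllValue : (C : ℚ) (k F : ℕ) → List ℚ → ℚ
flushAllValue C k F tx = flushAllFrom C k F (initState C k) tx

-- Let β = α - 1 = 1 / (1 - r). While FlushAll is running, use the potential β times the
-- collateral FlushAll has spent: in a slot where FlushAll settles v, OPT gains at most v,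
-- and α v pays for it and for the rise β v of the potential. When some v ≤ T fits no
-- wallet, every wallet has spent more than C/k - T, so the potential exceeds
-- β (C - kT) = C. From that slot until FlushAll is back online (F + 1 slots) the potential
-- is instead the collateral OPT can still spend in that window, at most C because each of
-- its wallets is reset at most once there. Hence V_OPT ≤ α V_FlushAll, with c = 0.

module Submission where

open import Defs
open import Data.Nat using (ℕ)
open import Data.Rational using (ℚ; 0ℚ; _+_; _*_; _≤_; _<_)
open import Data.List using (List)
open import Data.List.Relation.Unary.All using (All)
open import Data.Product using (Σ; _×_)

import Data.Bool as Bool
open import Data.Bool using (true; false; if_then_else_)
open import Data.Empty using (⊥-elim)
open import Data.Fin using (zero; suc)
open import Data.Fin.Subset using (Subset)
import Data.Integer as ℤ
import Data.Integer.Properties as ℤ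
open import Data.List using ([]; _∷_)
open import Data.List.Relation.Unary.All using ([]; _∷_)
open import Data.Maybe using (just; nothing)
open import Data.Nat using (zero; suc; s≤s; z≤n)
import Data.Nat as ℕ
import Data.Nat.Properties as ℕ
open import Data.Nat.Coprimality as Cop using (Coprime)
open import Data.Product using (_,_; proj₁; proj₂)
open import Data.Rational using (1ℚ; _-_; -_; 1/_; ≢-nonZero; _≤ᵇ_; mkℚ; nonNegative; positive)
import Data.Rational as ℚ
open import Data.Rational.Properties
open import Data.Vec using (Vec; []; _∷_; lookup; replicate; map; zipWith; _[_]≔_)
open import Data.Vec.Properties using (map-cong; map-id; map-const; map-replicate; zipWith-replicate₂)
import Data.Vec.Relation.Unary.All as V
open import Data.Vec.Relation.Unary.All using ([]; _∷_)
open import Data.Vec.Relation.Unary.All.Properties using (lookup⁺)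
open import Level using (0ℓ)
open import Relation.Binary.PropositionalEquality
open import Relation.Nullary using (yes; no)
open import Relation.Nullary.Decidable using (dec⇒maybe)
open import Tactic.RingSolver using (solve-∀)
open import Tactic.RingSolver.Core.AlmostCommutativeRing using (AlmostCommutativeRing; fromCommutativeRing)

ℚ-ring : AlmostCommutativeRing 0ℓ 0ℓ
ℚ-ring = fromCommutativeRing +-*-commutativeRing (λ p → dec⇒maybe (0ℚ ≟ p))

p≤q⇒0≤q-p : ∀ {p q} → p ≤ q → 0ℚ ≤ q - p
p≤q⇒0≤q-p {p} {q} p≤q = subst (_≤ q - p) (+-inverseʳ p) (+-monoˡ-≤ (- p) p≤q)

p<q⇒0<q-p : ∀ {p q} → p < q → 0ℚ < q - p
p<q⇒0<q-p {p} {q} p<q = subst (_< q - p) (+-inverseʳ p) (+-monoˡ-< (- p) p<q)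

p-q≤p : ∀ p {q} → 0ℚ ≤ q → p - q ≤ p
p-q≤p p {q} 0≤q = subst (p - q ≤_) (+-identityʳ p) (+-monoʳ-≤ p (neg-antimono-≤ 0≤q))

p-r≤p-q : ∀ p {q r} → q ≤ r → p - r ≤ p - q
p-r≤p-q p q≤r = +-monoʳ-≤ p (neg-antimono-≤ q≤r)

>0⇒≢0 : ∀ {p} → 0ℚ < p → p ≢ 0ℚ
>0⇒≢0 0<p = ≢-sym (<⇒≢ 0<p)

ℕ→ℚ-suc : ∀ n → ℕ→ℚ (suc n) ≡ 1ℚ + ℕ→ℚ n
ℕ→ℚ-suc n = begin
  ℕ→ℚ (suc n)                          ≡⟨ /-cong (cong (ℤ._+_ (ℤ.+ 1)) (sym (ℤ.*-identityʳ (ℤ.+ n)))) refl ⟩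
  1ℚ + mkℚ (ℤ.+ n) 0 n⊥1               ≡⟨ cong (1ℚ +_) (normalize-coprime n⊥1) ⟨
  1ℚ + ℕ→ℚ n                           ∎
  where
  open ≡-Reasoning
  n⊥1 : Coprime n 1
  n⊥1 = Cop.sym (Cop.1-coprimeTo n)

0<ℕ→ℚ-suc : ∀ n → 0ℚ < ℕ→ℚ (suc n)
0<ℕ→ℚ-suc n = positive⁻¹ (ℕ→ℚ (suc n)) {{normalize-pos (suc n) 1}}

*-÷?-cancel : ∀ p {q} → q ≢ 0ℚ → q * (p ÷? q) ≡ p
*-÷?-cancel p {q} q≢0 with q ≟ 0ℚ
... | yes q≡0 = ⊥-elim (q≢0 q≡0)
... | no q≢0′ = begin
  q * (p * 1/ q)   ≡⟨ x∙yz≈y∙xz q p (1/ q) ⟩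
  p * (q * 1/ q)   ≡⟨ cong (p *_) (*-inverseʳ q) ⟩
  p * 1ℚ           ≡⟨ *-identityʳ p ⟩
  p                ∎
  where
  open ≡-Reasoning
  instance
    q-nonZero : ℚ.NonZero q
    q-nonZero = ≢-nonZero q≢0′
  x∙yz≈y∙xz : ∀ x y z → x * (y * z) ≡ y * (x * z)
  x∙yz≈y∙xz = solve-∀ ℚ-ring

ℕ→ℚ*walletCap : ∀ C k → ℕ→ℚ (suc k) * walletCap C (suc k) ≡ C
ℕ→ℚ*walletCap C k = *-÷?-cancel C (>0⇒≢0 (0<ℕ→ℚ-suc k))

module _ {C T : ℚ} {k : ℕ} (0<C : 0ℚ < C) (kT<C : ℕ→ℚ k * T < C) where

  private
    r : ℚ
    r = ratio C T k

    C*r≡kT : C * r ≡ ℕ→ℚ k * T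
    C*r≡kT = *-÷?-cancel (ℕ→ℚ k * T) (>0⇒≢0 0<C)

    r<1 : r < 1ℚ
    r<1 = *-cancelˡ-<-nonNeg C {{nonNegative (<⇒≤ 0<C)}}
            (subst₂ _<_ (sym C*r≡kT) (sym (*-identityʳ C)) kT<C)

    [1-r]*[alpha-1]≡1 : (1ℚ - r) * (alpha C T k - 1ℚ) ≡ 1ℚ
    [1-r]*[alpha-1]≡1 = begin
      (1ℚ - r) * (α - 1ℚ)              ≡⟨ distrib (1ℚ - r) α ⟩
      (1ℚ - r) * α - (1ℚ - r)          ≡⟨ cong (_- (1ℚ - r)) (*-÷?-cancel ((1ℚ + 1ℚ) - r) (>0⇒≢0 (p<q⇒0<q-p r<1))) ⟩
      ((1ℚ + 1ℚ) - r) - (1ℚ - r)       ≡⟨ cancel r ⟩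
      1ℚ                               ∎
      where
      open ≡-Reasoning
      α : ℚ
      α = alpha C T k
      distrib : ∀ x y → x * (y - 1ℚ) ≡ x * y - x
      distrib = solve-∀ ℚ-ring
      cancel : ∀ x → ((1ℚ + 1ℚ) - x) - (1ℚ - x) ≡ 1ℚ
      cancel = solve-∀ ℚ-ring

  alpha-1*[C-kT]≡C : (alpha C T k - 1ℚ) * (C - ℕ→ℚ k * T) ≡ C
  alpha-1*[C-kT]≡C = begin
    β * (C - ℕ→ℚ k * T)    ≡⟨ cong (λ x → β * (C - x)) C*r≡kT ⟨
    β * (C - C * r)        ≡⟨ factor β C r ⟩
    C * ((1ℚ - r) * β)     ≡⟨ cong (C *_) [1-r]*[alpha-1]≡1 ⟩
    C * 1ℚ                 ≡⟨ *-identityʳ C ⟩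
    C                      ∎
    where
    open ≡-Reasoning
    β : ℚ
    β = alpha C T k - 1ℚ
    factor : ∀ b c x → b * (c - c * x) ≡ c * ((1ℚ - x) * b)
    factor = solve-∀ ℚ-ring

  0≤alpha-1 : 0ℚ ≤ alpha C T k - 1ℚ
  0≤alpha-1 = ≮⇒≥ λ β<0 → <-asym (positive⁻¹ 1ℚ)
    (subst₂ _<_ [1-r]*[alpha-1]≡1 (*-zeroʳ (1ℚ - r)) (*-monoʳ-<-pos (1ℚ - r) {{positive (p<q⇒0<q-p r<1)}} β<0))

amortise : ∀ α {g f O F Φ Φ′} → g + Φ′ ≤ α * f + Φ → O ≤ α * F + Φ′ → g + O ≤ α * (f + F) + Φ
amortise α {g} {f} {O} {F} {Φ} {Φ′} now later = begin
  g + O                  ≤⟨ +-monoʳ-≤ g later ⟩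
  g + (α * F + Φ′)       ≡⟨ regroup₁ g (α * F) Φ′ ⟩
  (g + Φ′) + α * F       ≤⟨ +-monoˡ-≤ (α * F) now ⟩
  (α * f + Φ) + α * F    ≡⟨ regroup₂ α f F Φ ⟩
  α * (f + F) + Φ        ∎
  where
  open ≤-Reasoning
  regroup₁ : ∀ a b c → a + (b + c) ≡ (a + c) + b
  regroup₁ = solve-∀ ℚ-ring
  regroup₂ : ∀ a x y c → (a * x + c) + a * y ≡ a * (x + y) + c
  regroup₂ = solve-∀ ℚ-ring

∑ : ∀ {A : Set} {n} → (A → ℚ) → Vec A n → ℚ
∑ f []       = 0ℚ
∑ f (x ∷ xs) = f x + ∑ f xs

module _ {A : Set} where

  ∑-mono-≤ : ∀ {n} {f g : A → ℚ} {xs : Vec A n} → V.All (λ x → f x ≤ g x) xs → ∑ f xs ≤ ∑ g xs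
  ∑-mono-≤ []       = ≤-refl
  ∑-mono-≤ (h ∷ hs) = +-mono-≤ h (∑-mono-≤ hs)

  ∑-const : ∀ {n} c (xs : Vec A n) → ∑ (λ _ → c) xs ≡ ℕ→ℚ n * c
  ∑-const c []                 = sym (*-zeroˡ c)
  ∑-const c (_∷_ {n} x xs) = begin
    c + ∑ (λ _ → c) xs     ≡⟨ cong (c +_) (∑-const c xs) ⟩
    c + ℕ→ℚ n * c          ≡⟨ collect c (ℕ→ℚ n) ⟩
    (1ℚ + ℕ→ℚ n) * c       ≡⟨ cong (_* c) (ℕ→ℚ-suc n) ⟨
    ℕ→ℚ (suc n) * c        ∎
    where
    open ≡-Reasoning
    collect : ∀ x m → x + m * x ≡ (1ℚ + m) * x
    collect = solve-∀ ℚ-ring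

  0≤∑ : ∀ {n} {f : A → ℚ} {xs : Vec A n} → V.All (λ x → 0ℚ ≤ f x) xs → 0ℚ ≤ ∑ f xs
  0≤∑ []       = ≤-refl
  0≤∑ (h ∷ hs) = +-mono-≤ h (0≤∑ hs)

  ∑-zero : ∀ {n} (xs : Vec A n) → ∑ (λ _ → 0ℚ) xs ≡ 0ℚ
  ∑-zero {n} xs = trans (∑-const 0ℚ xs) (*-zeroʳ (ℕ→ℚ n))

  ∑-[]≔ : ∀ {n} (f : A → ℚ) (xs : Vec A n) i x → ∑ f (xs [ i ]≔ x) ≡ ∑ f xs + (f x - f (lookup xs i))
  ∑-[]≔ f (y ∷ xs) zero    x = swap (f x) (f y) (∑ f xs)
    where
    swap : ∀ a b c → a + c ≡ (b + c) + (a - b)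
    swap = solve-∀ ℚ-ring
  ∑-[]≔ f (y ∷ xs) (suc i) x = trans (cong (f y +_) (∑-[]≔ f xs i x)) (sym (+-assoc (f y) _ _))

  All-replicate : ∀ {P : A → Set} {x} n → P x → V.All P (replicate n x)
  All-replicate zero    px = []
  All-replicate (suc n) px = px ∷ All-replicate n px

  All-[]≔ : ∀ {P : A → Set} {n} {xs : Vec A n} i {x} → V.All P xs → P x → V.All P (xs [ i ]≔ x)
  All-[]≔ zero    (_ ∷ pxs)  px = px ∷ pxs
  All-[]≔ (suc i) (py ∷ pxs) px = py ∷ All-[]≔ i pxs px

fits⇒≤ : ∀ {v R} → fitsᵇ v (online R) ≡ true → v ≤ R
fits⇒≤ fits = ≤ᵇ⇒≤ (subst Bool.T (sym fits) _)

¬fits⇒> : ∀ {v R} → fitsᵇ v (online R) ≡ false → R < v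
¬fits⇒> ¬fits = ≰⇒> λ v≤R → subst Bool.T ¬fits (≤⇒≤ᵇ v≤R)

firstFit-just : ∀ {n} v (s : Vec Wallet n) {i} → firstFit v s ≡ just i → fitsᵇ v (lookup s i) ≡ true
firstFit-just v (w ∷ s) eq with fitsᵇ v w in fits | eq
... | true  | refl = fits
... | false | _ with firstFit v s in eq′
firstFit-just v (w ∷ s) _ | false | refl | just i = firstFit-just v s eq′

firstFit-nothing : ∀ {n} v (s : Vec Wallet n) → firstFit v s ≡ nothing → V.All (λ w → fitsᵇ v w ≡ false) s
firstFit-nothing v []      _ = []
firstFit-nothing v (w ∷ s) eq with fitsᵇ v w in fits
... | false with firstFit v s in eq′
...   | nothing = fits ∷ firstFit-nothing v s eq′

firstFit-offline : ∀ n v {j} → firstFit v (replicate n (offline j)) ≡ nothing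
firstFit-offline zero    v = refl
firstFit-offline (suc n) v {j} rewrite firstFit-offline n v {j} = refl

anyOnline-offline : ∀ n {j} → anyOnline (replicate n (offline j)) ≡ false
anyOnline-offline zero    = refl
anyOnline-offline (suc n) = anyOnline-offline n

data SettleOutcome {n} (s : Vec Wallet n) (v : ℚ) : Vec Wallet n × ℚ → Set where
  discarded : SettleOutcome s v (s , 0ℚ)
  settled   : ∀ i {R} → lookup s i ≡ online R → v ≤ R → SettleOutcome s v (s [ i ]≔ online (R - v) , v)

settleStep-outcome : ∀ {n} (s : Vec Wallet n) v st → SettleOutcome s v (settleStep s v st)
settleStep-outcome s v nothing = discarded
settleStep-outcome s v (just i) with lookup s i in eq
... | offline _ = discarded
... | online R with v ≤ᵇ R in fits
...   | true  = settled i eq (fits⇒≤ fits)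
...   | false = discarded

settleStep-fits : ∀ {n} (s : Vec Wallet n) v i {R} → lookup s i ≡ online R → v ≤ R →
                  settleStep s v (just i) ≡ (s [ i ]≔ online (R - v) , v)
settleStep-fits s v i eq v≤R with lookup s i
settleStep-fits s v i refl v≤R | online R with v ≤ᵇ R in fits
... | true  = refl
... | false = ⊥-elim (subst Bool.T fits (≤⇒≤ᵇ v≤R))

module Wallets {cap : ℚ} (0≤cap : 0ℚ ≤ cap) (F : ℕ) where

  data Valid : Wallet → Set where
    online-valid  : ∀ {R} → 0ℚ ≤ R → R ≤ cap → Valid (online R)
    offline-valid : ∀ {j} → Valid (offline j)

  data Online : Wallet → Set where
    online-≤cap : ∀ {R} → R ≤ cap → Online (online R)

  Online⇒≡online : ∀ {w} → Online w → Σ ℚ λ R → (w ≡ online R) × (R ≤ cap)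
  Online⇒≡online (online-≤cap {R} R≤cap) = R , refl , R≤cap

  endOfSlot : ∀ {n} → Vec Wallet n → Subset n → Vec Wallet n
  endOfSlot s flushed = zipWith (applyFlush F) (map (tick cap) s) flushed

  spent : Wallet → ℚ
  spent (online R)  = cap - R
  spent (offline _) = 0ℚ

  -- Bounds what the wallet can settle during the current slot and the m - 1 next ones when
  -- m ≤ F + 1, since it is then reset at most once in that window.
  spendable : ℕ → Wallet → ℚ
  spendable m (online R)  = R
  spendable m (offline j) = if j ℕ.<ᵇ m then cap else 0ℚ

  0≤spendable : ∀ m {w} → Valid w → 0ℚ ≤ spendable m w
  0≤spendable m (online-valid 0≤R _) = 0≤R
  0≤spendable m (offline-valid {j}) with j ℕ.<ᵇ m
  ... | true  = 0≤cap
  ... | false = ≤-refl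

  spendable≤cap : ∀ m {w} → Valid w → spendable m w ≤ cap
  spendable≤cap m (online-valid _ R≤cap) = R≤cap
  spendable≤cap m (offline-valid {j}) with j ℕ.<ᵇ m
  ... | true  = ≤-refl
  ... | false = 0≤cap

  spendable-endOfSlot : ∀ {n} → 1 ℕ.≤ n → n ℕ.≤ F → ∀ flush {w} → Valid w →
                        spendable n (applyFlush F (tick cap w) flush) ≤ spendable (suc n) w
  spendable-endOfSlot {n} _ n≤F true vw with F ℕ.<ᵇ n in F<n
  ... | true  = ⊥-elim (ℕ.≤⇒≯ n≤F (ℕ.<ᵇ⇒< F n (subst Bool.T (sym F<n) _)))
  ... | false = 0≤spendable (suc n) vw
  spendable-endOfSlot _         _ false (online-valid _ _)           = ≤-refl
  spendable-endOfSlot (s≤s z≤n) _ false (offline-valid {zero})        = ≤-refl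
  spendable-endOfSlot (s≤s z≤n) _ false (offline-valid {suc zero})    = ≤-refl
  spendable-endOfSlot _         _ false (offline-valid {suc (suc _)}) = ≤-refl

  tick-valid : ∀ {w} → Valid w → Valid (tick cap w)
  tick-valid (online-valid 0≤R R≤cap)      = online-valid 0≤R R≤cap
  tick-valid (offline-valid {zero})        = online-valid 0≤cap ≤-refl
  tick-valid (offline-valid {suc zero})    = online-valid 0≤cap ≤-refl
  tick-valid (offline-valid {suc (suc _)}) = offline-valid

  endOfSlot-valid : ∀ {n} {s : Vec Wallet n} (flushed : Subset n) → V.All Valid s → V.All Valid (endOfSlot s flushed)
  endOfSlot-valid []           []        = []
  endOfSlot-valid (true  ∷ bs) (_  ∷ vs) = offline-valid ∷ endOfSlot-valid bs vs
  endOfSlot-valid (false ∷ bs) (vw ∷ vs) = tick-valid vw ∷ endOfSlot-valid bs vs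

  ∑-endOfSlot : ∀ {n} {f g : Wallet → ℚ} →
                (∀ flush {w} → Valid w → g (applyFlush F (tick cap w) flush) ≤ f w) →
                {s : Vec Wallet n} (flushed : Subset n) → V.All Valid s → ∑ g (endOfSlot s flushed) ≤ ∑ f s
  ∑-endOfSlot decays []       []        = ≤-refl
  ∑-endOfSlot decays (b ∷ bs) (vw ∷ vs) = +-mono-≤ (decays b vw) (∑-endOfSlot decays bs vs)

  endOfSlot-keep : ∀ {n} (s : Vec Wallet n) → endOfSlot s (replicate n false) ≡ map (tick cap) s
  endOfSlot-keep s = trans (zipWith-replicate₂ (applyFlush F) (map (tick cap) s) false) (map-id _)

  endOfSlot-flushAll : ∀ {n} (s : Vec Wallet n) → endOfSlot s (replicate n true) ≡ replicate n (offline F)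
  endOfSlot-flushAll s = trans (zipWith-replicate₂ (applyFlush F) (map (tick cap) s) true) (map-const _ (offline F))

  map-tick-online : ∀ {n} {s : Vec Wallet n} → V.All Online s → map (tick cap) s ≡ s
  map-tick-online []                  = refl
  map-tick-online (online-≤cap _ ∷ os) = cong (_ ∷_) (map-tick-online os)

  anyOnline-online : ∀ {n} {s : Vec Wallet (suc n)} → V.All Online s → anyOnline s ≡ true
  anyOnline-online (online-≤cap _ ∷ _) = refl

  ∑-spent-fresh : ∀ n → ∑ spent (replicate n (online cap)) ≡ 0ℚ
  ∑-spent-fresh zero    = refl
  ∑-spent-fresh (suc n) = cong₂ _+_ (+-inverseʳ cap) (∑-spent-fresh n)

  outcome-valid : ∀ {n} {s : Vec Wallet n} {v r} → SettleOutcome s v r → V.All Valid s → 0ℚ ≤ v →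
                  V.All Valid (proj₁ r)
  outcome-valid discarded vs _ = vs
  outcome-valid (settled i {R} eq v≤R) vs 0≤v with subst Valid eq (lookup⁺ vs i)
  ... | online-valid _ R≤cap = All-[]≔ i vs (online-valid (p≤q⇒0≤q-p v≤R) (≤-trans (p-q≤p R 0≤v) R≤cap))

  outcome-gain≤ : ∀ {n} {s : Vec Wallet n} {v r} → SettleOutcome s v r → 0ℚ ≤ v → proj₂ r ≤ v
  outcome-gain≤ discarded       0≤v = 0≤v
  outcome-gain≤ (settled _ _ _) _   = ≤-refl

  outcome-conserves : ∀ {n} {f : Wallet → ℚ} → (∀ R → f (online R) ≡ R) →
                      {s : Vec Wallet n} {v : ℚ} {r : Vec Wallet n × ℚ} → SettleOutcome s v r →
                      proj₂ r + ∑ f (proj₁ r) ≡ ∑ f s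
  outcome-conserves reads discarded = +-identityˡ _
  outcome-conserves {f = f} reads {s} {v} (settled i {R} eq _) = begin
    v + ∑ f (s [ i ]≔ online (R - v))                  ≡⟨ cong (v +_) (∑-[]≔ f s i (online (R - v))) ⟩
    v + (∑ f s + (f (online (R - v)) - f (lookup s i))) ≡⟨ cong (λ x → v + (∑ f s + x)) spend ⟩
    v + (∑ f s + ((R - v) - R))                        ≡⟨ cancel v (∑ f s) R ⟩
    ∑ f s                                               ∎
    where
    open ≡-Reasoning
    spend : f (online (R - v)) - f (lookup s i) ≡ (R - v) - R
    spend = cong₂ _-_ (reads (R - v)) (trans (cong f eq) (reads R))
    cancel : ∀ a b c → a + (b + ((c - a) - c)) ≡ b
    cancel = solve-∀ ℚ-ring

module FlushAllAnalysis (C T : ℚ) (k′ F′ : ℕ) (0<C : 0ℚ < C) (0<T : 0ℚ < T) (T<cap : T < walletCap C (suc k′)) where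

  k : ℕ
  k = suc k′

  F : ℕ
  F = suc F′

  cap : ℚ
  cap = walletCap C k

  0≤cap : 0ℚ ≤ cap
  0≤cap = <⇒≤ (<-trans 0<T T<cap)

  open Wallets 0≤cap F

  kT<C : ℕ→ℚ k * T < C
  kT<C = subst (ℕ→ℚ k * T <_) (ℕ→ℚ*walletCap C k′)
           (*-monoʳ-<-pos (ℕ→ℚ k) {{positive (0<ℕ→ℚ-suc k′)}} T<cap)

  α : ℚ
  α = alpha C T k

  β : ℚ
  β = α - 1ℚ

  0≤β : 0ℚ ≤ β
  0≤β = 0≤alpha-1 {C} {T} {k} 0<C kT<C

  β*[C-kT]≡C : β * (C - ℕ→ℚ k * T) ≡ C
  β*[C-kT]≡C = alpha-1*[C-kT]≡C {C} {T} {k} 0<C kT<C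

  α*0+x≡x : ∀ x → α * 0ℚ + x ≡ x
  α*0+x≡x x = trans (cong (_+ x) (*-zeroʳ α)) (+-identityˡ x)

  -- step turns the flush set into booleans by a local map Side → Bool, which is the identity.
  step-as-endOfSlot : ∀ s v st flushed →
                      step C k F s v (act st flushed) ≡ (endOfSlot (proj₁ (settleStep s v st)) flushed , proj₂ (settleStep s v st))
  step-as-endOfSlot s v st flushed =
    cong (λ b → endOfSlot (proj₁ (settleStep s v st)) b , proj₂ (settleStep s v st))
         (trans (map-cong (λ { true → refl ; false → refl }) flushed) (map-id flushed))

  step-valid : ∀ s v a → V.All Valid s → 0ℚ ≤ v → V.All Valid (proj₁ (step C k F s v a))
  step-valid s v (act st flushed) vs 0≤v =
    subst (λ r → V.All Valid (proj₁ r)) (sym (step-as-endOfSlot s v st flushed))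
          (endOfSlot-valid flushed (outcome-valid (settleStep-outcome s v st) vs 0≤v))

  step-gain≤ : ∀ s v a → 0ℚ ≤ v → proj₂ (step C k F s v a) ≤ v
  step-gain≤ s v (act st _) = outcome-gain≤ (settleStep-outcome s v st)

  step-potential : ∀ {f g : Wallet → ℚ} → (∀ R → f (online R) ≡ R) →
                   (∀ flush {w} → Valid w → g (applyFlush F (tick cap w) flush) ≤ f w) →
                   ∀ s v a → V.All Valid s → 0ℚ ≤ v →
                   proj₂ (step C k F s v a) + ∑ g (proj₁ (step C k F s v a)) ≤ ∑ f s
  step-potential {f} {g} reads decays s v (act st flushed) vs 0≤v =
    subst (λ r → proj₂ r + ∑ g (proj₁ r) ≤ ∑ f s) (sym (step-as-endOfSlot s v st flushed)) (begin
    gain + ∑ g (endOfSlot s′ flushed)  ≤⟨ +-monoʳ-≤ gain (∑-endOfSlot decays flushed (outcome-valid outcome vs 0≤v)) ⟩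
    gain + ∑ f s′                      ≡⟨ outcome-conserves reads outcome ⟩
    ∑ f s                              ∎)
    where
    open ≤-Reasoning
    outcome : SettleOutcome s v (settleStep s v st)
    outcome = settleStep-outcome s v st
    s′ : State k
    s′ = proj₁ (settleStep s v st)
    gain : ℚ
    gain = proj₂ (settleStep s v st)

  data RunningStep (s : State k) (v : ℚ) : State k × ℚ → Set where
    settles : ∀ {s′} → V.All Online s′ → ∑ spent s′ ≡ ∑ spent s + v → RunningStep s v (s′ , v)
    flushes : ℕ→ℚ k * (cap - T) ≤ ∑ spent s → RunningStep s v (replicate k (offline F) , 0ℚ)

  flushAll-settles : ∀ {s} v i → V.All Online s → firstFit v s ≡ just i → 0ℚ ≤ v →
                     RunningStep s v (step C k F s v (act (just i) (noneSet k)))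
  flushAll-settles {s} v i on ff 0≤v with Online⇒≡online (lookup⁺ on i)
  ... | R , eq , R≤cap =
    subst (RunningStep s v) (sym step≡) (settles on′ spent≡)
    where
    open ≡-Reasoning
    v≤R : v ≤ R
    v≤R = fits⇒≤ (trans (cong (fitsᵇ v) (sym eq)) (firstFit-just v s ff))
    s′ : State k
    s′ = s [ i ]≔ online (R - v)
    on′ : V.All Online s′
    on′ = All-[]≔ i on (online-≤cap (≤-trans (p-q≤p R 0≤v) R≤cap))
    step≡ : step C k F s v (act (just i) (noneSet k)) ≡ (s′ , v)
    step≡ = begin
      step C k F s v (act (just i) (noneSet k))
        ≡⟨ step-as-endOfSlot s v (just i) (noneSet k) ⟩
      endOfSlot (proj₁ (settleStep s v (just i))) (noneSet k) , proj₂ (settleStep s v (just i))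
        ≡⟨ cong (λ r → endOfSlot (proj₁ r) (noneSet k) , proj₂ r) (settleStep-fits s v i eq v≤R) ⟩
      endOfSlot s′ (noneSet k) , v
        ≡⟨ cong (_, v) (trans (endOfSlot-keep s′) (map-tick-online on′)) ⟩
      s′ , v ∎
    spent≡ : ∑ spent s′ ≡ ∑ spent s + v
    spent≡ = begin
      ∑ spent s′                                                ≡⟨ ∑-[]≔ spent s i (online (R - v)) ⟩
      ∑ spent s + (spent (online (R - v)) - spent (lookup s i)) ≡⟨ cong (λ w → ∑ spent s + ((cap - (R - v)) - spent w)) eq ⟩
      ∑ spent s + ((cap - (R - v)) - (cap - R))                 ≡⟨ cong (∑ spent s +_) (cancel cap R v) ⟩
      ∑ spent s + v                                             ∎
      where
      cancel : ∀ c r x → (c - (r - x)) - (c - r) ≡ x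
      cancel = solve-∀ ℚ-ring

  flushAll-flushes : ∀ {s} v → V.All Online s → firstFit v s ≡ nothing → v ≤ T →
                     RunningStep s v (step C k F s v (act nothing (if anyOnline s then allSet k else noneSet k)))
  flushAll-flushes {s} v on ff v≤T rewrite anyOnline-online on =
    subst (RunningStep s v) (sym step≡) (flushes (subst (_≤ ∑ spent s) (∑-const (cap - T) s) (∑-mono-≤ spent≥)))
    where
    step≡ : step C k F s v (act nothing (allSet k)) ≡ (replicate k (offline F) , 0ℚ)
    step≡ = trans (step-as-endOfSlot s v nothing (allSet k)) (cong (_, 0ℚ) (endOfSlot-flushAll s))
    spent≥ : V.All (λ w → cap - T ≤ spent w) s
    spent≥ = V.map (λ { (online-≤cap _ , ¬fits) → p-r≤p-q cap (<⇒≤ (<-≤-trans (¬fits⇒> ¬fits) v≤T)) })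
                   (V.zip (on , firstFit-nothing v s ff))

  flushAll-running : ∀ {s} v → V.All Online s → 0ℚ ≤ v → v ≤ T →
                     RunningStep s v (step C k F s v (flushAllAction s v))
  flushAll-running {s} v on 0≤v v≤T with firstFit v s in ff
  ... | just i  = flushAll-settles v i on ff 0≤v
  ... | nothing = flushAll-flushes v on ff v≤T

  flushAll-paused : ∀ m v → step C k F (replicate k (offline m)) v (flushAllAction (replicate k (offline m)) v)
                            ≡ (replicate k (tick cap (offline m)) , 0ℚ)
  flushAll-paused m v rewrite firstFit-offline k v {m} | anyOnline-offline k {m} =
    trans (step-as-endOfSlot (replicate k (offline m)) v nothing (noneSet k))
          (cong (_, 0ℚ) (trans (endOfSlot-keep _) (map-replicate (tick cap) (offline m) k)))

  -- paused m: FlushAll is offline during the current slot and the m next ones.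
  data FlushAllState : State k → Set where
    running : ∀ {s} → V.All Online s → FlushAllState s
    paused  : ∀ m → m ℕ.< F → FlushAllState (replicate k (offline (suc m)))

  potential : ∀ {sF} → State k → FlushAllState sF → ℚ
  potential {sF} _  (running _)  = β * ∑ spent sF
  potential      sO (paused m _) = ∑ (spendable (suc m)) sO

  0≤potential : ∀ {sO sF} (st : FlushAllState sF) → V.All Valid sO → 0ℚ ≤ potential sO st
  0≤potential {sF = sF} (running on) _ =
    subst (_≤ β * ∑ spent sF) (*-zeroʳ β) (*-monoˡ-≤-nonNeg β {{nonNegative 0≤β}} (0≤∑ (V.map 0≤spent on)))
    where
    0≤spent : ∀ {w} → Online w → 0ℚ ≤ spent w
    0≤spent (online-≤cap R≤cap) = p≤q⇒0≤q-p R≤cap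
  0≤potential (paused m _) vO = 0≤∑ (V.map (0≤spendable (suc m)) vO)

  StepBound : ∀ {sF} → State k → FlushAllState sF → State k × ℚ → State k × ℚ → Set
  StepBound sO st (sO′ , gO) (sF′ , gF) = Σ (FlushAllState sF′) λ st′ → gO + potential sO′ st′ ≤ α * gF + potential sO st

  running-step : ∀ {sO sF} (on : V.All Online sF) v a {rF} → V.All Valid sO → 0ℚ ≤ v →
                 RunningStep sF v rF → StepBound sO (running on) (step C k F sO v a) rF
  running-step {sO} {sF} _ v a vO 0≤v (settles {s′} on′ spent≡) = running on′ , (begin
    gO + β * ∑ spent s′          ≡⟨ cong (λ x → gO + β * x) spent≡ ⟩
    gO + β * (∑ spent sF + v)    ≤⟨ +-monoˡ-≤ _ (step-gain≤ sO v a 0≤v) ⟩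
    v + β * (∑ spent sF + v)     ≡⟨ shift α (∑ spent sF) v ⟩
    α * v + β * ∑ spent sF       ∎)
    where
    open ≤-Reasoning
    gO : ℚ
    gO = proj₂ (step C k F sO v a)
    shift : ∀ a S x → x + (a - 1ℚ) * (S + x) ≡ a * x + (a - 1ℚ) * S
    shift = solve-∀ ℚ-ring
  running-step {sO} {sF} _ v a vO 0≤v (flushes spent≥) = paused F′ ℕ.≤-refl , (begin
    gO + ∑ (spendable F) sO′     ≤⟨ step-potential (λ _ → refl) (spendable-endOfSlot (s≤s z≤n) ℕ.≤-refl) sO v a vO 0≤v ⟩
    ∑ (spendable (suc F)) sO     ≤⟨ subst (∑ (spendable (suc F)) sO ≤_) (∑-const cap sO) (∑-mono-≤ (V.map (spendable≤cap (suc F)) vO)) ⟩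
    ℕ→ℚ k * cap                  ≡⟨ ℕ→ℚ*walletCap C k′ ⟩
    C                            ≡⟨ β*[C-kT]≡C ⟨
    β * (C - ℕ→ℚ k * T)          ≡⟨ cong (β *_) slack ⟨
    β * (ℕ→ℚ k * (cap - T))      ≤⟨ *-monoˡ-≤-nonNeg β {{nonNegative 0≤β}} spent≥ ⟩
    β * ∑ spent sF               ≡⟨ α*0+x≡x _ ⟨
    α * 0ℚ + β * ∑ spent sF      ∎)
    where
    open ≤-Reasoning
    gO : ℚ
    gO = proj₂ (step C k F sO v a)
    sO′ : State k
    sO′ = proj₁ (step C k F sO v a)
    distrib : ∀ x a b → x * (a - b) ≡ x * a - x * b
    distrib = solve-∀ ℚ-ring
    slack : ℕ→ℚ k * (cap - T) ≡ C - ℕ→ℚ k * T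
    slack = trans (distrib (ℕ→ℚ k) cap T) (cong (_- ℕ→ℚ k * T) (ℕ→ℚ*walletCap C k′))

  paused-step : ∀ {sO} m (m<F : m ℕ.< F) v a → V.All Valid sO → 0ℚ ≤ v →
                StepBound sO (paused m m<F) (step C k F sO v a) (replicate k (tick cap (offline (suc m))) , 0ℚ)
  paused-step {sO} zero _ v a vO 0≤v = running (All-replicate k (online-≤cap ≤-refl)) , (begin
    gO + β * ∑ spent (replicate k (online cap))  ≡⟨ cong (gO +_) nothing-left ⟩
    gO + ∑ (λ _ → 0ℚ) sO′                        ≤⟨ step-potential (λ _ → refl) (λ _ → 0≤spendable 1) sO v a vO 0≤v ⟩
    ∑ (spendable 1) sO                           ≡⟨ α*0+x≡x _ ⟨
    α * 0ℚ + ∑ (spendable 1) sO                  ∎)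
    where
    open ≤-Reasoning
    gO : ℚ
    gO = proj₂ (step C k F sO v a)
    sO′ : State k
    sO′ = proj₁ (step C k F sO v a)
    nothing-left : β * ∑ spent (replicate k (online cap)) ≡ ∑ (λ _ → 0ℚ) sO′
    nothing-left = trans (cong (β *_) (∑-spent-fresh k)) (trans (*-zeroʳ β) (sym (∑-zero sO′)))
  paused-step {sO} (suc m) m<F v a vO 0≤v = paused m (ℕ.<-trans (ℕ.n<1+n m) m<F) , (begin
    gO + ∑ (spendable (suc m)) sO′ ≤⟨ step-potential (λ _ → refl) (spendable-endOfSlot (s≤s z≤n) (ℕ.<⇒≤ m<F)) sO v a vO 0≤v ⟩
    ∑ (spendable (suc (suc m))) sO ≡⟨ α*0+x≡x _ ⟨
    α * 0ℚ + ∑ (spendable (suc (suc m))) sO ∎)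
    where
    open ≤-Reasoning
    gO : ℚ
    gO = proj₂ (step C k F sO v a)
    sO′ : State k
    sO′ = proj₁ (step C k F sO v a)

  amortised-step : ∀ {sF} sO (st : FlushAllState sF) v a → V.All Valid sO → 0ℚ ≤ v → v ≤ T →
                   StepBound sO st (step C k F sO v a) (step C k F sF v (flushAllAction sF v))
  amortised-step sO (running on) v a vO 0≤v v≤T = running-step on v a vO 0≤v (flushAll-running v on 0≤v v≤T)
  amortised-step sO (paused m m<F) v a vO 0≤v _ =
    subst (StepBound sO (paused m m<F) (step C k F sO v a)) (sym (flushAll-paused (suc m) v))
          (paused-step m m<F v a vO 0≤v)

  competitive-from : ∀ tx → All (λ v → (0ℚ ≤ v) × (v ≤ T)) tx → ∀ σ t sO {sF} (st : FlushAllState sF) →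
                     V.All Valid sO → valueFrom C k F σ t sO tx ≤ α * flushAllFrom C k F sF tx + potential sO st
  competitive-from []       []                  σ t sO st vO = subst (0ℚ ≤_) (sym (α*0+x≡x _)) (0≤potential st vO)
  competitive-from (v ∷ tx) ((0≤v , v≤T) ∷ bs) σ t sO {sF} st vO with amortised-step sO st v (σ t) vO 0≤v v≤T
  ... | st′ , now = amortise α {proj₂ (step C k F sO v (σ t))} {proj₂ (step C k F sF v (flushAllAction sF v))} now
                      (competitive-from tx bs σ (suc t) _ st′ (step-valid sO v (σ t) vO 0≤v))

  competitive : ∀ tx → All (λ v → (0ℚ ≤ v) × (v ≤ T)) tx → (σ : ℕ → Action k) →
                policyValue C k F σ tx ≤ α * flushAllValue C k F tx + 0ℚ
  competitive tx bs σ = begin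
    policyValue C k F σ tx                                   ≤⟨ competitive-from tx bs σ 0 fresh (running fresh-online) fresh-valid ⟩
    α * flushAllValue C k F tx + β * ∑ spent fresh           ≡⟨ cong (λ x → α * flushAllValue C k F tx + β * x) (∑-spent-fresh k) ⟩
    α * flushAllValue C k F tx + β * 0ℚ                      ≡⟨ cong (α * flushAllValue C k F tx +_) (*-zeroʳ β) ⟩
    α * flushAllValue C k F tx + 0ℚ                          ∎
    where
    open ≤-Reasoning
    fresh : State k
    fresh = initState C k
    fresh-online : V.All Online fresh
    fresh-online = All-replicate k (online-≤cap ≤-refl)
    fresh-valid : V.All Valid fresh
    fresh-valid = All-replicate k (online-valid 0≤cap ≤-refl)

theorem1 : (C T : ℚ) (k F : ℕ) → 0ℚ < C → 1 Data.Nat.≤ k → 1 Data.Nat.≤ F →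
    0ℚ < T → T < walletCap C k →
    Σ ℚ (λ c → (tx : List ℚ) → All (λ v → (0ℚ ≤ v) × (v ≤ T)) tx →
      (σ : ℕ → Action k) →
      policyValue C k F σ tx ≤ alpha C T k * flushAllValue C k F tx + c)
theorem1 C T (suc k′) (suc F′) 0<C _ _ 0<T T<cap = 0ℚ , FlushAllAnalysis.competitive C T k′ F′ 0<C 0<T T<cap
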